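{- If $F$ is a linear formula, then $P_F=\mathrm{Id}_{\mathcal{P}|F|}$.
   Context: Here a linear formula is one built from the constants $\mathbf{0},\top,\mathbf{1},\bot$ (without atoms) using the linear connectives, interpreted as interfaces $(|F|,P_F)$ ($P_F$ a monotonic predicate transformer on $\mathcal{P}(|F|)$) as follows: $\mathbf{0}=(\emptyset,\mathrm{Id})$, $\top=\mathbf{0}^\perp$, $\mathbf{1}=(\{*\},\mathrm{Id})$, $\bot=\mathbf{1}^\perp$; dual $X^\perp=(|X|,x\mapsto\overline{P_X(\overline{x})})$; $X\otimes Y$ on $|X|\times|Y|$ with $r\mapsto\bigcup_{x\times y\subseteq r}P_X(x)\times P_Y(y)$; $X\&Y$ on $|X|+|Y|$ with $(x,y)\mapsto(P_X(x),P_Y(y))$; $X\mathbin{\text{⅋}}Y=(X^\perp\otimes Y^\perp)^\perp$; $X\oplus Y=(X^\perp\&Y^\perp)^\perp$; $X\multimap Y=X^\perp\mathbin{\text{⅋}}Y$; $!X=(\mathcal{M}_{\mathrm{fin}}(|X|),!P_X)$ with $[a_1,\dots,a_n]\in!P_X(U)$ iff there are $x_i$ with $\prod_i x_i\subseteq U$ (where $\prod_i x_i$ is the set of multisets $[b_1,\dots,b_n]$ with $b_i\in x_i$) and $a_i\in P_X(x_i)$; $?X=(!(X^\perp))^\perp$. -}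

module Defs where

open import Level using (Level; Lift; 0ℓ) renaming (suc to lsuc)
open import Data.Empty using (⊥)
open import Data.Unit using (⊤; tt)
open import Data.Product using (Σ; ∃; _×_; _,_; proj₁; proj₂; Σ-syntax)
open import Data.Sum using (_⊎_; inj₁; inj₂)
open import Data.List using (List)
open import Data.List.Relation.Binary.Pointwise using (Pointwise)
open import Data.List.Relation.Binary.Permutation.Propositional using (_↭_)
open import Relation.Nullary using (¬_)

-- Webs are sets presented with an equivalence (to model M_fin as a
-- quotient of lists by permutation).  Subsets of a web are predicates
-- respecting that equivalence.

record Interface : Set₂ where
  field
    Carrier : Set
    _≈_     : Carrier → Carrier → Set

  Respects : (Carrier → Set) → Set
  Respects U = ∀ a b → a ≈ b → (U a → U b) × (U b → U a)

  Subset : Set₁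
  Subset = Σ (Carrier → Set) Respects

  field
    -- a predicate transformer on P(|F|): input subset, output subset
    -- (output lives in Set₁ since it quantifies over subsets)
    P : Subset → Carrier → Set₁

open Interface public

compl : (X : Interface) → Subset X → Subset X
compl X (U , r) = (λ a → ¬ U a) , λ a b e → (λ nu ub → nu (proj₂ (r a b e) ub))
                                          , (λ nu ua → nu (proj₁ (r a b e) ua))

dual : Interface → Interface
dual X = record { Carrier = Carrier X ; _≈_ = _≈_ X
                ; P = λ U a → ¬ P X (compl X U) a }

𝟘 𝟙 ⊤I ⊥I : Interface
𝟘 = record { Carrier = ⊥ ; _≈_ = λ _ _ → ⊤ ; P = λ U a → Lift (lsuc 0ℓ) (proj₁ U a) }
𝟙 = record { Carrier = ⊤ ; _≈_ = λ _ _ → ⊤ ; P = λ U a → Lift (lsuc 0ℓ) (proj₁ U a) }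
⊤I = dual 𝟘
⊥I = dual 𝟙

_⊗I_ : Interface → Interface → Interface
X ⊗I Y = record
  { Carrier = Carrier X × Carrier Y
  ; _≈_ = λ { (a , b) (a' , b') → _≈_ X a a' × _≈_ Y b b' }
  ; P = λ { r (a , b) → Σ[ x ∈ Subset X ] Σ[ y ∈ Subset Y ]
              ((∀ a' b' → proj₁ x a' → proj₁ y b' → proj₁ r (a' , b'))
               × P X x a × P Y y b) } }

sum≈ : (X Y : Interface) → Carrier X ⊎ Carrier Y → Carrier X ⊎ Carrier Y → Set
sum≈ X Y (inj₁ a) (inj₁ a') = _≈_ X a a'
sum≈ X Y (inj₂ b) (inj₂ b') = _≈_ Y b b'
sum≈ X Y _ _ = ⊥

restrictˡ : (X Y : Interface) → (U : Carrier X ⊎ Carrier Y → Set) →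
            (∀ a b → sum≈ X Y a b → (U a → U b) × (U b → U a)) → Subset X
restrictˡ X Y U r = (λ a → U (inj₁ a)) , λ a b e → r (inj₁ a) (inj₁ b) e

restrictʳ : (X Y : Interface) → (U : Carrier X ⊎ Carrier Y → Set) →
            (∀ a b → sum≈ X Y a b → (U a → U b) × (U b → U a)) → Subset Y
restrictʳ X Y U r = (λ b → U (inj₂ b)) , λ a b e → r (inj₂ a) (inj₂ b) e

_&I_ : Interface → Interface → Interface
X &I Y = record
  { Carrier = Carrier X ⊎ Carrier Y
  ; _≈_ = sum≈ X Y
  ; P = λ { (U , r) (inj₁ a) → P X (restrictˡ X Y U r) a
          ; (U , r) (inj₂ b) → P Y (restrictʳ X Y U r) b } }

_⅋I_ _⊕I_ _⊸I_ : Interface → Interface → Interface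
X ⅋I Y = dual (dual X ⊗I dual Y)
X ⊕I Y = dual (dual X &I dual Y)
X ⊸I Y = dual X ⅋I Y

_≈ₘ_ : {A : Set} → (A → A → Set) → List A → List A → Set
_≈ₘ_ {A} R as bs = Σ[ cs ∈ List A ] (Pointwise R as cs × cs ↭ bs)

-- !X on M_fin(|X|): [a₁,…,aₙ] ∈ !P_X(U) iff there are x₁,…,xₙ with
-- ∏ xᵢ ⊆ U and aᵢ ∈ P_X(xᵢ), where ∏ xᵢ is the set of multisets
-- [b₁,…,bₙ] with bᵢ ∈ xᵢ.
!I : Interface → Interface
!I X = record
  { Carrier = List (Carrier X)
  ; _≈_ = _≈ₘ_ (_≈_ X)
  ; P = λ U as → Σ[ xs ∈ List (Subset X) ]
          ((∀ bs → (Σ[ cs ∈ List (Carrier X) ]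
                      (Pointwise (λ c x → proj₁ x c) cs xs × _≈ₘ_ (_≈_ X) cs bs))
                   → proj₁ U bs)
           × Pointwise (λ a x → P X x a) as xs) }

?I : Interface → Interface
?I X = dual (!I (dual X))

data Formula : Set where
  `0 `⊤ `1 `⊥ : Formula
  _`⊗_ _`⅋_ _`&_ _`⊕_ _`⊸_ : Formula → Formula → Formula
  `!_ `?_ : Formula → Formula

⟦_⟧ : Formula → Interface
⟦ `0 ⟧ = 𝟘
⟦ `⊤ ⟧ = ⊤I
⟦ `1 ⟧ = 𝟙
⟦ `⊥ ⟧ = ⊥I
⟦ A `⊗ B ⟧ = ⟦ A ⟧ ⊗I ⟦ B ⟧
⟦ A `⅋ B ⟧ = ⟦ A ⟧ ⅋I ⟦ B ⟧
⟦ A `& B ⟧ = ⟦ A ⟧ &I ⟦ B ⟧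
⟦ A `⊕ B ⟧ = ⟦ A ⟧ ⊕I ⟦ B ⟧
⟦ A `⊸ B ⟧ = ⟦ A ⟧ ⊸I ⟦ B ⟧
⟦ `! A ⟧ = !I ⟦ A ⟧
⟦ `? A ⟧ = ?I ⟦ A ⟧

-- The units 𝟘 and 𝟙 carry the identity by definition;
-- ⊗ and & preserve the identity, and so does the dual, classically, since
-- P_{X^⊥}(U) is then the complement of the complement of U.  For ⊗ the witnesses
-- of (a , b) ∈ P(U) are the largest rectangle through (a , b) inside U, and for !
-- they are the equivalence classes of the elements of the multiset; this is why
-- the webs' relations must be shown to be equivalences along the way.
module Submission where

open import Defs
open import Level using (0ℓ; lift; lower)
open import Data.Product using (_×_; _,_; proj₁; proj₂; Σ-syntax)
open import Data.Sum using (inj₁; inj₂)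
open import Data.List as List using (List; []; _∷_)
open import Data.List.Relation.Binary.Pointwise as Pointwise using (Pointwise; []; _∷_)
open import Data.List.Relation.Binary.Permutation.Propositional
  using (_↭_; refl; prep; swap; trans; ↭-refl; ↭-sym; ↭-trans)
open import Relation.Binary.Core using (Rel)
open import Relation.Binary.Definitions using (Reflexive)
open import Relation.Binary.Structures using (IsEquivalence)
open import Axiom.ExcludedMiddle using (ExcludedMiddle)
open import Axiom.DoubleNegationElimination using (em⇒dne)

IsIdentity : Interface → Set₁
IsIdentity X = ∀ U a → (P X U a → proj₁ U a) × (proj₁ U a → P X U a)

module _ {A : Set} {R : Rel A 0ℓ} where

  ↭-Pointwise-commute : ∀ {xs ys zs} → xs ↭ ys → Pointwise R ys zs →
                        Σ[ ws ∈ List A ] (Pointwise R xs ws × ws ↭ zs)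
  ↭-Pointwise-commute {zs = zs} refl rs = zs , rs , ↭-refl
  ↭-Pointwise-commute (prep x p) (r ∷ rs) =
    let ws , rs′ , p′ = ↭-Pointwise-commute p rs in _ , r ∷ rs′ , prep _ p′
  ↭-Pointwise-commute (swap x y p) (r₁ ∷ r₂ ∷ rs) =
    let ws , rs′ , p′ = ↭-Pointwise-commute p rs in _ , r₂ ∷ r₁ ∷ rs′ , swap _ _ p′
  ↭-Pointwise-commute (trans p q) rs =
    let vs , rs₁ , q′ = ↭-Pointwise-commute q rs
        ws , rs₂ , p′ = ↭-Pointwise-commute p rs₁
    in ws , rs₂ , ↭-trans p′ q′

  ≈ₘ-isEquivalence : IsEquivalence R → IsEquivalence (_≈ₘ_ R)
  ≈ₘ-isEquivalence isEq = record
    { refl  = λ {as} → as , Pointwise.refl R-refl , ↭-refl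
    ; sym   = λ (cs , rs , p) → ↭-Pointwise-commute (↭-sym p) (Pointwise.symmetric R-sym rs)
    ; trans = λ (cs , rs , p) (ds , ss , q) →
        let ws , ss′ , p′ = ↭-Pointwise-commute p ss
        in ws , Pointwise.transitive R-trans rs ss′ , ↭-trans p′ q
    }
    where open IsEquivalence isEq renaming (refl to R-refl; sym to R-sym; trans to R-trans)

⊗-isEquivalence : ∀ X Y → IsEquivalence (_≈_ X) → IsEquivalence (_≈_ Y) →
                  IsEquivalence (_≈_ (X ⊗I Y))
⊗-isEquivalence X Y isEqX isEqY = record
  { refl  = X.refl , Y.refl
  ; sym   = λ (p , q) → X.sym p , Y.sym q
  ; trans = λ (p , q) (p′ , q′) → X.trans p p′ , Y.trans q q′
  }
  where
  module X = IsEquivalence isEqX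
  module Y = IsEquivalence isEqY

&-isEquivalence : ∀ X Y → IsEquivalence (_≈_ X) → IsEquivalence (_≈_ Y) →
                  IsEquivalence (_≈_ (X &I Y))
&-isEquivalence X Y isEqX isEqY = record
  { refl  = λ {a} → refl′ a
  ; sym   = λ {a} {b} → sym′ a b
  ; trans = λ {a} {b} {c} → trans′ a b c
  }
  where
  module X = IsEquivalence isEqX
  module Y = IsEquivalence isEqY
  _≈⊎_ = sum≈ X Y

  refl′ : ∀ a → a ≈⊎ a
  refl′ (inj₁ a) = X.refl
  refl′ (inj₂ b) = Y.refl

  sym′ : ∀ a b → a ≈⊎ b → b ≈⊎ a
  sym′ (inj₁ a) (inj₁ a′) = X.sym
  sym′ (inj₂ b) (inj₂ b′) = Y.sym

  trans′ : ∀ a b c → a ≈⊎ b → b ≈⊎ c → a ≈⊎ c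
  trans′ (inj₁ a) (inj₁ a′) (inj₁ a″) = X.trans
  trans′ (inj₂ b) (inj₂ b′) (inj₂ b″) = Y.trans

!-isEquivalence : ∀ X → IsEquivalence (_≈_ X) → IsEquivalence (_≈_ (!I X))
!-isEquivalence X = ≈ₘ-isEquivalence

⟦⟧-isEquivalence : ∀ F → IsEquivalence (_≈_ ⟦ F ⟧)
⟦⟧-isEquivalence `0 = _
⟦⟧-isEquivalence `⊤ = _
⟦⟧-isEquivalence `1 = _
⟦⟧-isEquivalence `⊥ = _
⟦⟧-isEquivalence (A `⊗ B) = ⊗-isEquivalence ⟦ A ⟧ ⟦ B ⟧ (⟦⟧-isEquivalence A) (⟦⟧-isEquivalence B)
⟦⟧-isEquivalence (A `⅋ B) = ⊗-isEquivalence (dual ⟦ A ⟧) (dual ⟦ B ⟧) (⟦⟧-isEquivalence A) (⟦⟧-isEquivalence B)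
⟦⟧-isEquivalence (A `& B) = &-isEquivalence ⟦ A ⟧ ⟦ B ⟧ (⟦⟧-isEquivalence A) (⟦⟧-isEquivalence B)
⟦⟧-isEquivalence (A `⊕ B) = &-isEquivalence (dual ⟦ A ⟧) (dual ⟦ B ⟧) (⟦⟧-isEquivalence A) (⟦⟧-isEquivalence B)
⟦⟧-isEquivalence (A `⊸ B) = ⊗-isEquivalence (dual ⟦ A ⟧) (dual ⟦ B ⟧) (⟦⟧-isEquivalence A) (⟦⟧-isEquivalence B)
⟦⟧-isEquivalence (`! A) = !-isEquivalence ⟦ A ⟧ (⟦⟧-isEquivalence A)
⟦⟧-isEquivalence (`? A) = !-isEquivalence (dual ⟦ A ⟧) (⟦⟧-isEquivalence A)

⟦⟧-refl : ∀ F → Reflexive (_≈_ ⟦ F ⟧)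
⟦⟧-refl F = IsEquivalence.refl (⟦⟧-isEquivalence F)

𝟘-isIdentity : IsIdentity 𝟘
𝟘-isIdentity U a = lower , lift

𝟙-isIdentity : IsIdentity 𝟙
𝟙-isIdentity U a = lower , lift

dual-isIdentity : ExcludedMiddle 0ℓ → ∀ X → IsIdentity X → IsIdentity (dual X)
dual-isIdentity em X idX U a =
  (λ ¬P∁U → em⇒dne em λ ¬Ua → ¬P∁U (proj₂ (idX (compl X U) a) ¬Ua)) ,
  (λ Ua P∁U → proj₁ (idX (compl X U) a) P∁U Ua)

⊗-isIdentity : ∀ X Y → Reflexive (_≈_ X) → Reflexive (_≈_ Y) →
               IsIdentity X → IsIdentity Y → IsIdentity (X ⊗I Y)
⊗-isIdentity X Y reflX reflY idX idY (U , resp) (a , b) = sound , complete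
  where
  sound : P (X ⊗I Y) (U , resp) (a , b) → U (a , b)
  sound (x , y , x×y⊆U , a∈Px , b∈Py) =
    x×y⊆U a b (proj₁ (idX x a) a∈Px) (proj₁ (idY y b) b∈Py)

  x : Subset X
  x = (λ a′ → U (a′ , b)) , λ a₁ a₂ a₁≈a₂ → resp _ _ (a₁≈a₂ , reflY)

  y : Subset Y
  y = (λ b′ → ∀ a′ → U (a′ , b) → U (a′ , b′)) ,
      λ b₁ b₂ b₁≈b₂ → (λ f a′ u → proj₁ (resp _ _ (reflX , b₁≈b₂)) (f a′ u))
                    , (λ f a′ u → proj₂ (resp _ _ (reflX , b₁≈b₂)) (f a′ u))

  complete : U (a , b) → P (X ⊗I Y) (U , resp) (a , b)
  complete Uab = x , y , (λ a′ b′ a′∈x b′∈y → b′∈y a′ a′∈x)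
               , proj₂ (idX x a) Uab , proj₂ (idY y b) (λ a′ u → u)

&-isIdentity : ∀ X Y → IsIdentity X → IsIdentity Y → IsIdentity (X &I Y)
&-isIdentity X Y idX idY (U , resp) (inj₁ a) = idX (restrictˡ X Y U resp) a
&-isIdentity X Y idX idY (U , resp) (inj₂ b) = idY (restrictʳ X Y U resp) b

!-isIdentity : ∀ X → IsEquivalence (_≈_ X) → IsIdentity X → IsIdentity (!I X)
!-isIdentity X isEq idX (U , resp) as = sound , complete
  where
  module ≈ = IsEquivalence isEq
  _∈ₛ_ : Carrier X → Subset X → Set
  c ∈ₛ x = proj₁ x c

  sound : P (!I X) (U , resp) as → U as
  sound (xs , ∏xs⊆U , as∈Pxs) =
    ∏xs⊆U as (as , Pointwise.map (λ {a} {x} → proj₁ (idX x a)) as∈Pxs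
                 , IsEquivalence.refl (!-isEquivalence X isEq))

  class : Carrier X → Subset X
  class a = (λ b → _≈_ X b a) , λ b₁ b₂ b₁≈b₂ → ≈.trans (≈.sym b₁≈b₂) , ≈.trans b₁≈b₂

  classes : List (Carrier X) → List (Subset X)
  classes = List.map class

  ∈-classes : ∀ as → Pointwise (λ a x → P X x a) as (classes as)
  ∈-classes []       = []
  ∈-classes (a ∷ as) = proj₂ (idX (class a) a) ≈.refl ∷ ∈-classes as

  ∈-classes⇒≈ : ∀ as {cs} → Pointwise _∈ₛ_ cs (classes as) → Pointwise (_≈_ X) as cs
  ∈-classes⇒≈ []       []         = []
  ∈-classes⇒≈ (a ∷ as) (c≈a ∷ cs) = ≈.sym c≈a ∷ ∈-classes⇒≈ as cs

  complete : U as → P (!I X) (U , resp) as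
  complete Uas = classes as , ∏classes⊆U , ∈-classes as
    where
    ∏classes⊆U : ∀ bs → Σ[ cs ∈ List (Carrier X) ]
                   (Pointwise _∈ₛ_ cs (classes as) × _≈ₘ_ (_≈_ X) cs bs) → U bs
    ∏classes⊆U bs (cs , cs∈classes , cs≈bs) =
      proj₁ (resp cs bs cs≈bs) (proj₁ (resp as cs (cs , ∈-classes⇒≈ as cs∈classes , ↭-refl)) Uas)

⅋-isIdentity : ExcludedMiddle 0ℓ → ∀ X Y → Reflexive (_≈_ X) → Reflexive (_≈_ Y) →
               IsIdentity X → IsIdentity Y → IsIdentity (X ⅋I Y)
⅋-isIdentity em X Y reflX reflY idX idY =
  dual-isIdentity em _ (⊗-isIdentity (dual X) (dual Y) reflX reflY
    (dual-isIdentity em X idX) (dual-isIdentity em Y idY))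

⊕-isIdentity : ExcludedMiddle 0ℓ → ∀ X Y → IsIdentity X → IsIdentity Y → IsIdentity (X ⊕I Y)
⊕-isIdentity em X Y idX idY =
  dual-isIdentity em _ (&-isIdentity (dual X) (dual Y)
    (dual-isIdentity em X idX) (dual-isIdentity em Y idY))

?-isIdentity : ExcludedMiddle 0ℓ → ∀ X → IsEquivalence (_≈_ X) → IsIdentity X → IsIdentity (?I X)
?-isIdentity em X isEq idX =
  dual-isIdentity em _ (!-isIdentity (dual X) isEq (dual-isIdentity em X idX))

proposition5 : ExcludedMiddle 0ℓ → (F : Formula) → (U : Subset ⟦ F ⟧) → (a : Carrier ⟦ F ⟧) →
    (P ⟦ F ⟧ U a → proj₁ U a) × (proj₁ U a → P ⟦ F ⟧ U a)
proposition5 em `0 = 𝟘-isIdentity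
proposition5 em `1 = 𝟙-isIdentity
proposition5 em `⊤ = dual-isIdentity em 𝟘 𝟘-isIdentity
proposition5 em `⊥ = dual-isIdentity em 𝟙 𝟙-isIdentity
proposition5 em (A `⊗ B) =
  ⊗-isIdentity ⟦ A ⟧ ⟦ B ⟧ (⟦⟧-refl A) (⟦⟧-refl B) (proposition5 em A) (proposition5 em B)
proposition5 em (A `⅋ B) =
  ⅋-isIdentity em ⟦ A ⟧ ⟦ B ⟧ (⟦⟧-refl A) (⟦⟧-refl B) (proposition5 em A) (proposition5 em B)
proposition5 em (A `⊸ B) =
  ⅋-isIdentity em (dual ⟦ A ⟧) ⟦ B ⟧ (⟦⟧-refl A) (⟦⟧-refl B)
    (dual-isIdentity em ⟦ A ⟧ (proposition5 em A)) (proposition5 em B)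
proposition5 em (A `& B) = &-isIdentity ⟦ A ⟧ ⟦ B ⟧ (proposition5 em A) (proposition5 em B)
proposition5 em (A `⊕ B) = ⊕-isIdentity em ⟦ A ⟧ ⟦ B ⟧ (proposition5 em A) (proposition5 em B)
proposition5 em (`! A) = !-isIdentity ⟦ A ⟧ (⟦⟧-isEquivalence A) (proposition5 em A)
proposition5 em (`? A) = ?-isIdentity em ⟦ A ⟧ (⟦⟧-isEquivalence A) (proposition5 em A)
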